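{- Let $(A,\le)$ be a partially ordered set and let $a\in A$. Then the induced relation $\le_a$ is a partial order (reflexive, transitive and antisymmetric) on the free monoid $A_a^*$.
   Context: All order relations are reflexive. For a set $X$, $X^*$ denotes the free monoid of finite words over $X$ (including the empty word), and $|w|$ is the length of a word $w$; for $n\in\mathbb{N}$, $A^n$ is identified with the words of length $n$ over $A$ and carries the product order ($v\le w$ iff $v_i\le w_i$ in $A$ for all $i=1,\dots,n$, where $v_i$ is the $i$-th letter). For $a\in A$ put $A_a=A\setminus\{a\}$ and $A_a^*=(A\setminus\{a\})^*$. A word $w'\in A^*$ is an $a$-extension of a word $w\in A_a^*$ if $w'$ is obtained from $w$ by inserting finitely many (possibly zero) copies of the letter $a$ at arbitrary positions (equivalently, deleting all occurrences of $a$ from $w'$ yields $w$). The induced relation $\le_a$ on $A_a^*$ is defined by: $v\le_a w$ iff there exist an $a$-extension $v'$ of $v$ and an $a$-extension $w'$ of $w$ with $|v'|=|w'|=n$ for some $n$ and $v'_i\le w'_i$ in $A$ for every $i=1,\dots,n$. -}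

module Defs where

open import Level using (Level)
open import Data.List using (List; []; _∷_)
open import Data.List.Relation.Unary.All using (All)
open import Data.List.Relation.Binary.Pointwise using (Pointwise)
open import Data.Product using (∃₂; _×_)
open import Relation.Binary.PropositionalEquality using (_≢_)

-- Words over A are lists. For a ∈ A, the free monoid A_a^* is represented
-- as the words all of whose letters differ from a.
Word-a : ∀ {c} {A : Set c} → A → List A → Set c
Word-a a w = All (_≢ a) w

data AExt {c} {A : Set c} (a : A) : List A → List A → Set c where
  ext-[] : AExt a [] []
  ext-∷  : ∀ {x w w'} → AExt a w w' → AExt a (x ∷ w) (x ∷ w')
  ext-a  : ∀ {w w'} → AExt a w w' → AExt a w (a ∷ w')

-- The induced relation ≤_a : v ≤_a w iff there are a-extensions v', w' of
-- v, w of the same length n with v'_i ≤ w'_i for all i (Pointwise forces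
-- equal length and letterwise comparison, i.e. the product order on A^n).
Induced : ∀ {c ℓ} {A : Set c} → (A → A → Set ℓ) → A → List A → List A → Set (c Level.⊔ ℓ)
Induced _≤_ a v w = ∃₂ λ v' w' → AExt a v v' × AExt a w w' × Pointwise _≤_ v' w'

{-# OPTIONS --safe #-}
-- Reflexivity and transitivity are routine: two a-extensions of a word have a
-- common a-extension, and a pointwise comparison survives inserting an a on one
-- side opposite an a inserted on the other.
-- Antisymmetry rests on one rigidity fact: two a-extensions xs, ys of the same
-- a-free word with xs ≤ ys pointwise are equal. At the first position where
-- they differ, say xs has a and ys a letter y, we get a < y, and xs is now a
-- letter behind ys. Reading on, every letter of ys that has to be matched by a
-- pending letter of xs (or by an a) is again strictly above a, so xs never
-- catches up, while both words must end together. The case where ys has the a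
-- is the same argument for the reversed order.
module Submission where

open import Defs
open import Level using (Level; _⊔_)
open import Function.Base using (flip)
open import Data.List using (List; []; _∷_; _++_; _∷ʳ_)
open import Data.List.Properties using (∷ʳ-++)
open import Data.List.Relation.Unary.All using (All; []; _∷_)
open import Data.List.Relation.Unary.All.Properties using (∷ʳ⁺)
open import Data.List.Relation.Binary.Pointwise as Pointwise
  using (Pointwise; []; _∷_; Pointwise-≡⇒≡)
open import Data.Product using (_×_; _,_; ∃; ∃₂)
open import Data.Empty using (⊥-elim)
open import Relation.Nullary using (¬_)
open import Relation.Binary.Core using (Rel)
open import Relation.Binary.PropositionalEquality using (_≡_; _≢_; refl; subst; cong; sym)
open import Relation.Binary.Structures using (IsPartialOrder)
import Relation.Binary.Construct.Flip.EqAndOrd as Flip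

private
  variable
    c ℓ : Level

module _ {A : Set c} (a : A) where

  AExt-refl : ∀ w → AExt a w w
  AExt-refl []      = ext-[]
  AExt-refl (x ∷ w) = ext-∷ (AExt-refl w)

  AExt-trans : ∀ {u v w} → AExt a u v → AExt a v w → AExt a u w
  AExt-trans ext-[]    ext-[]    = ext-[]
  AExt-trans (ext-∷ e) (ext-∷ f) = ext-∷ (AExt-trans e f)
  AExt-trans (ext-a e) (ext-∷ f) = ext-a (AExt-trans e f)
  AExt-trans e         (ext-a f) = ext-a (AExt-trans e f)

  AExt-amalgamate : ∀ {v xs ys} → AExt a v xs → AExt a v ys →
                    ∃ λ zs → AExt a xs zs × AExt a ys zs
  AExt-amalgamate (ext-a e) f =
    let zs , g , h = AExt-amalgamate e f in a ∷ zs , ext-∷ g , ext-a h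
  AExt-amalgamate e (ext-a f) =
    let zs , g , h = AExt-amalgamate e f in a ∷ zs , ext-a g , ext-∷ h
  AExt-amalgamate ext-[]    ext-[]    = [] , ext-[] , ext-[]
  AExt-amalgamate (ext-∷ e) (ext-∷ f) =
    let zs , g , h = AExt-amalgamate e f in _ ∷ zs , ext-∷ g , ext-∷ h

  common-AExt⇒≡ : ∀ {v w xs} → Word-a a v → Word-a a w →
                  AExt a v xs → AExt a w xs → v ≡ w
  common-AExt⇒≡ _         _         ext-[]    ext-[]    = refl
  common-AExt⇒≡ v≢a       w≢a       (ext-a e) (ext-a f) = common-AExt⇒≡ v≢a w≢a e f
  common-AExt⇒≡ (_ ∷ v≢a) (_ ∷ w≢a) (ext-∷ e) (ext-∷ f) = cong (_ ∷_) (common-AExt⇒≡ v≢a w≢a e f)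
  common-AExt⇒≡ (a≢a ∷ _) _         (ext-∷ _) (ext-a _) = ⊥-elim (a≢a refl)
  common-AExt⇒≡ _         (a≢a ∷ _) (ext-a _) (ext-∷ _) = ⊥-elim (a≢a refl)

  module _ {_∼_ : Rel A ℓ} (a∼a : a ∼ a) where

    Pointwise-AExtʳ : ∀ {xs ys ys'} → Pointwise _∼_ xs ys → AExt a ys ys' →
                      ∃ λ xs' → AExt a xs xs' × Pointwise _∼_ xs' ys'
    Pointwise-AExtʳ []            ext-[]    = [] , ext-[] , []
    Pointwise-AExtʳ (x∼y ∷ xs∼ys) (ext-∷ e) =
      let xs' , f , xs'∼ys' = Pointwise-AExtʳ xs∼ys e in _ ∷ xs' , ext-∷ f , x∼y ∷ xs'∼ys'
    Pointwise-AExtʳ xs∼ys         (ext-a e) =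
      let xs' , f , xs'∼ys' = Pointwise-AExtʳ xs∼ys e in a ∷ xs' , ext-a f , a∼a ∷ xs'∼ys'

  Pointwise-AExtˡ : ∀ {_∼_ : Rel A ℓ} {xs ys xs'} → a ∼ a →
                    Pointwise _∼_ xs ys → AExt a xs xs' →
                    ∃ λ ys' → AExt a ys ys' × Pointwise _∼_ xs' ys'
  Pointwise-AExtˡ {_∼_ = _∼_} a∼a xs∼ys e =
    let ys' , f , ys'∼xs' = Pointwise-AExtʳ {_∼_ = flip _∼_} a∼a (Pointwise.symmetric (λ p → p) xs∼ys) e
    in ys' , f , Pointwise.symmetric (λ p → p) ys'∼xs'

module Surplus {A : Set c} {_≤_ : Rel A ℓ} (po : IsPartialOrder _≡_ _≤_) (a : A) where
  open IsPartialOrder po using (trans; antisym)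

  StrictlyAbove : A → Set (c ⊔ ℓ)
  StrictlyAbove z = a ≤ z × z ≢ a

  private
    enqueue : ∀ p {y : A} {u xs} → AExt a (p ++ y ∷ u) xs → AExt a (p ∷ʳ y ++ u) xs
    enqueue p {y} {u} = subst (λ w → AExt a w _) (sym (∷ʳ-++ p y u))

  -- The invariant of the rigidity argument: xs still owes the letters z ∷ q,
  -- which ys has already matched.
  surplus-above⇒¬≤ : ∀ {z q u xs ys} → All StrictlyAbove (z ∷ q) → Word-a a u →
                     AExt a (z ∷ q ++ u) xs → AExt a u ys → ¬ Pointwise _≤_ xs ys
  surplus-above⇒¬≤ above u≢a (ext-a e) (ext-a f) (_ ∷ xs≤ys) =
    surplus-above⇒¬≤ above u≢a e f xs≤ys
  surplus-above⇒¬≤ {z} {q} above (y≢a ∷ u≢a) (ext-a e) (ext-∷ f) (a≤y ∷ xs≤ys) =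
    surplus-above⇒¬≤ (∷ʳ⁺ above (a≤y , y≢a)) u≢a (enqueue (z ∷ q) e) f xs≤ys
  surplus-above⇒¬≤ ((a≤z , z≢a) ∷ _) _ (ext-∷ _) (ext-a _) (z≤a ∷ _) =
    z≢a (antisym z≤a a≤z)
  surplus-above⇒¬≤ {q = []} ((a≤z , _) ∷ []) (y≢a ∷ u≢a) (ext-∷ e) (ext-∷ f) (z≤y ∷ xs≤ys) =
    surplus-above⇒¬≤ ((trans a≤z z≤y , y≢a) ∷ []) u≢a e f xs≤ys
  surplus-above⇒¬≤ {q = z′ ∷ q} ((a≤z , _) ∷ above) (y≢a ∷ u≢a) (ext-∷ e) (ext-∷ f) (z≤y ∷ xs≤ys) =
    surplus-above⇒¬≤ (∷ʳ⁺ above (trans a≤z z≤y , y≢a)) u≢a (enqueue (z′ ∷ q) e) f xs≤ys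

module _ {A : Set c} {_≤_ : Rel A ℓ} (po : IsPartialOrder _≡_ _≤_) (a : A) where
  open IsPartialOrder po using () renaming (refl to ≤-refl)
  module ≤* = IsPartialOrder (Pointwise.isPartialOrder po)
  module Above = Surplus po a
  module Below = Surplus (Flip.isPartialOrder po) a

  ≤-between-AExts⇒≡ : ∀ {v xs ys} → Word-a a v → AExt a v xs → AExt a v ys →
                      Pointwise _≤_ xs ys → xs ≡ ys
  ≤-between-AExts⇒≡ _ ext-[] ext-[] [] = refl
  ≤-between-AExts⇒≡ v≢a (ext-a e) (ext-a f) (_ ∷ xs≤ys) =
    cong (a ∷_) (≤-between-AExts⇒≡ v≢a e f xs≤ys)
  ≤-between-AExts⇒≡ (_ ∷ v≢a) (ext-∷ e) (ext-∷ f) (_ ∷ xs≤ys) =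
    cong (_ ∷_) (≤-between-AExts⇒≡ v≢a e f xs≤ys)
  ≤-between-AExts⇒≡ (y≢a ∷ v≢a) (ext-a e) (ext-∷ f) (a≤y ∷ xs≤ys) =
    ⊥-elim (Above.surplus-above⇒¬≤ ((a≤y , y≢a) ∷ []) v≢a e f xs≤ys)
  ≤-between-AExts⇒≡ (y≢a ∷ v≢a) (ext-∷ e) (ext-a f) (y≤a ∷ xs≤ys) =
    ⊥-elim (Below.surplus-above⇒¬≤ ((y≤a , y≢a) ∷ []) v≢a f e (Pointwise.symmetric (λ p → p) xs≤ys))

  Induced-align : ∀ {u v w} → Induced _≤_ a u v → Induced _≤_ a v w →
                  ∃₂ λ us vs → ∃ λ ws → AExt a u us × AExt a v vs × AExt a w ws
                    × Pointwise _≤_ us vs × Pointwise _≤_ vs ws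
  Induced-align (u' , v' , u⊑u' , v⊑v' , u'≤v') (v'' , w' , v⊑v'' , w⊑w' , v''≤w') =
    let vs , v'⊑vs , v''⊑vs = AExt-amalgamate a v⊑v' v⊑v''
        us , u'⊑us , us≤vs = Pointwise-AExtʳ a ≤-refl u'≤v' v'⊑vs
        ws , w'⊑ws , vs≤ws = Pointwise-AExtˡ a ≤-refl v''≤w' v''⊑vs
    in us , vs , ws , AExt-trans a u⊑u' u'⊑us , AExt-trans a v⊑v' v'⊑vs
       , AExt-trans a w⊑w' w'⊑ws , us≤vs , vs≤ws

  Induced-refl : ∀ w → Induced _≤_ a w w
  Induced-refl w = w , w , AExt-refl a w , AExt-refl a w , ≤*.refl

  Induced-trans : ∀ {u v w} → Induced _≤_ a u v → Induced _≤_ a v w → Induced _≤_ a u w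
  Induced-trans u≤v v≤w =
    let us , _ , ws , u⊑us , _ , w⊑ws , us≤vs , vs≤ws = Induced-align u≤v v≤w
    in us , ws , u⊑us , w⊑ws , ≤*.trans us≤vs vs≤ws

  Induced-antisym : ∀ {v w} → Word-a a v → Word-a a w →
                    Induced _≤_ a v w → Induced _≤_ a w v → v ≡ w
  Induced-antisym {w = w} v≢a w≢a v≤w w≤v =
    let us , ws , us' , v⊑us , w⊑ws , v⊑us' , us≤ws , ws≤us' = Induced-align v≤w w≤v
        us≡us' = ≤-between-AExts⇒≡ v≢a v⊑us v⊑us' (≤*.trans us≤ws ws≤us')
        us≡ws  = Pointwise-≡⇒≡ (≤*.antisym us≤ws (subst (Pointwise _≤_ _) (sym us≡us') ws≤us'))
    in common-AExt⇒≡ a v≢a w≢a v⊑us (subst (AExt a w) (sym us≡ws) w⊑ws)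

theorem2p2 : ∀ {c ℓ} {A : Set c} (_≤_ : A → A → Set ℓ) →
    IsPartialOrder _≡_ _≤_ → (a : A) →
    ((w : List A) → Word-a a w → Induced _≤_ a w w)
    × ((u v w : List A) → Word-a a u → Word-a a v → Word-a a w →
    Induced _≤_ a u v → Induced _≤_ a v w → Induced _≤_ a u w)
    × ((v w : List A) → Word-a a v → Word-a a w →
    Induced _≤_ a v w → Induced _≤_ a w v → v ≡ w)
theorem2p2 _≤_ po a =
    (λ w _ → Induced-refl po a w)
  , (λ _ _ _ _ _ _ → Induced-trans po a)
  , (λ _ _ → Induced-antisym po a)
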